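{- For all integers $q\ge 2$ and $m \geq 2$, $$\chi_\rho(H_{q,m}) = m-1 + q^m - \alpha\bigl(H_{q,m}^{[m-1]}\bigr),$$ where $\alpha$ denotes the stability number (maximum size of a stable set).
   Context: For integers $q\ge 2$ and $m\ge 1$, the Hamming graph $H_{q,m}$ has vertex set $\{0,\ldots,q-1\}^m$, two vertices being adjacent if and only if they differ in exactly one coordinate. For a graph $G=(V,E)$, a packing $k$-coloring of $G$ is a partition $V_1,\ldots,V_k$ of $V$ such that for every $i\in\{1,\ldots,k\}$, any two distinct vertices $u,v\in V_i$ are at distance at least $i+1$ in $G$; the packing chromatic number $\chi_\rho(G)$ is the smallest $k$ for which a packing $k$-coloring exists. For a graph $G$ and integer $k\ge 1$, $G^k$ is the graph on $V(G)$ in which distinct $u,v$ are adjacent iff $d_G(u,v)\le k$ (so $G^1=G$). For a finite set $F$ of positive integers, $G^F$ is the graph with vertex set $\{(v,k): v\in V(G),\ k\in F\}$ and edge set $$\bigcup_{k\in F}\{((u,k),(v,k)) : (u,v)\in E(G^k)\}\ \cup \bigcup_{j,k\in F,\ j<k}\{((v,j),(v,k)) : v\in V(G)\}.$$ For a positive integer $p$, $[p]=\{1,\ldots,p\}$ and $G^{[p]}$ denotes $G^F$ with $F=[p]$. -}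

module Defs where

open import Data.Nat using (ℕ; zero; suc; _+_; _≤_; _<_)
open import Data.Fin using (Fin; toℕ)
open import Data.Fin.Properties using () renaming (_≟_ to _≟F_)
open import Data.Vec using (Vec; []; _∷_)
open import Data.List using (List; length)
open import Data.List.Membership.Propositional using (_∈_)
open import Data.List.Relation.Unary.Unique.Propositional using (Unique)
open import Data.Product using (Σ; _×_; _,_; ∃)
open import Data.Sum using (_⊎_)
open import Relation.Nullary using (¬_; yes; no)
open import Relation.Binary.PropositionalEquality using (_≡_; _≢_)

record Graph : Set₁ where
  field
    V : Set
    E : V → V → Set
open Graph public

data Walk (G : Graph) : V G → V G → ℕ → Set where
  nil  : ∀ {u} → Walk G u u 0
  cons : ∀ {u w v n} → E G u w → Walk G w v n → Walk G u v (suc n)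

-- d_G(u,v) ≤ k  (false when u and v are in different components: distance ∞)
Dist≤ : (G : Graph) → ℕ → V G → V G → Set
Dist≤ G k u v = ∃ λ n → n ≤ k × Walk G u v n

diffCount : ∀ {q m} → Vec (Fin q) m → Vec (Fin q) m → ℕ
diffCount [] [] = 0
diffCount (x ∷ xs) (y ∷ ys) with x ≟F y
... | yes _ = diffCount xs ys
... | no  _ = suc (diffCount xs ys)

Hamming : ℕ → ℕ → Graph
Hamming q m = record { V = Vec (Fin q) m ; E = λ u v → diffCount u v ≡ 1 }

-- G^[p]: vertices (v,k) with k ∈ [p] (k represented by Fin p, k = toℕ k + 1).
-- (u,k)~(v,k) iff uv is an edge of G^k (u ≠ v, d_G(u,v) ≤ k);
-- (v,j)~(v,k) for j ≠ k.
PowerUpTo : Graph → ℕ → Graph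
PowerUpTo G p = record
  { V = V G × Fin p
  ; E = λ { (u , j) (v , k) →
          (j ≡ k × u ≢ v × Dist≤ G (suc (toℕ k)) u v)
          ⊎ (u ≡ v × j ≢ k) } }

IsStable : (G : Graph) → List (V G) → Set
IsStable G S = ∀ {x y} → x ∈ S → y ∈ S → ¬ E G x y

IsStabilityNumber : (G : Graph) → ℕ → Set
IsStabilityNumber G a =
  (Σ (List (V G)) λ S → Unique S × IsStable G S × length S ≡ a)
  × (∀ (S : List (V G)) → Unique S → IsStable G S → length S ≤ a)

-- Packing k-coloring: class of colour i (= toℕ c + 1) has pairwise distances ≥ i+1,
-- i.e. no two distinct vertices of colour i are joined by a walk of length ≤ i.
IsPackingColoring : (G : Graph) (k : ℕ) → (V G → Fin k) → Set
IsPackingColoring G k c =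
  ∀ u v → u ≢ v → c u ≡ c v → ¬ Dist≤ G (suc (toℕ (c u))) u v

HasPackingColoring : Graph → ℕ → Set
HasPackingColoring G k = Σ (V G → Fin k) (IsPackingColoring G k)

IsPackingChromaticNumber : Graph → ℕ → Set
IsPackingChromaticNumber G k =
  HasPackingColoring G k × (∀ j → j < k → ¬ HasPackingColoring G j)

-- A stable set of G^[p] contains at most one copy (v , i) of each vertex v, so it is a partial
-- labelling of V(G) by 1, …, p in which vertices with the same label i are at distance > i: a
-- packing colouring of part of G with the colours 1, …, p. Completing a largest one by a fresh
-- colour for every unlabelled vertex gives a packing colouring with p + n − α colours. Conversely,
-- if diam G ≤ p + 1 and some packing colouring uses j ≥ p colours, its colours 1, …, p form such a
-- labelling, so at least n − α vertices get the other colours, which must be pairwise distinct: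
-- j ≥ p + n − α. For H_{q,m} the diameter is m = p + 1, and every packing colouring needs more
-- than m colours: two words of colour t remain distinct after deleting their first t coordinates,
-- so colour t is used at most q^(m−t) times, and the first m colours cannot cover all q^m words.

module Submission where

open import Defs
open import Data.Nat using (_≟_; >-nonZero; ℕ; zero; suc; _+_; _*_; _∸_; _^_; _≤_; _<_; z≤n; s≤s; _≤?_; _<?_)
open import Data.Nat.Properties
open import Algebra.Properties.CommutativeSemigroup +-commutativeSemigroup using (interchange)
open import Function using (id)
open import Data.Fin using (Fin; toℕ; fromℕ<; _↑ˡ_; _↑ʳ_)
open import Data.Fin.Properties using (toℕ-injective; toℕ<n; toℕ-fromℕ<; toℕ-↑ˡ; toℕ-↑ʳ; ↑ˡ-injective; ↑ʳ-injective) renaming (_≟_ to _≟F_)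
open import Data.Vec as Vec using (Vec; []; _∷_)
import Data.Vec.Properties as VecP
open import Data.List as List using (List; []; _∷_; length; filter; map; cartesianProductWith; allFin; upTo; removeAt; mapMaybe)
open import Data.List.Properties using (mapMaybe-cong; length-map; length-++; length-removeAt′; length-upTo; length-tabulate; filter-all; filter-none)
open import Data.List.Membership.Propositional using (_∈_)
open import Data.List.Membership.Propositional.Properties using (∈-map⁺; ∈-cartesianProductWith⁺; ∈-allFin; ∈-filter⁺; ∈-filter⁻; ∈-upTo⁺; ∈-++⁺ˡ; ∈-++⁺ʳ)
open import Data.List.Relation.Unary.Any using (here; there; index)
open import Data.List.Relation.Unary.Any.Properties using (lookup-index)
open import Data.List.Relation.Unary.All.Properties using (all-filter)
open import Data.List.Extrema.Nat using (argmax; argmax-all; f[xs]≤f[argmax])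
open import Data.List.Relation.Unary.All as All using (All; []; _∷_)
open import Data.List.Relation.Unary.Unique.Propositional using (Unique)
open import Data.List.Relation.Unary.AllPairs using ([]; _∷_)
open import Data.List.Relation.Unary.Unique.Propositional.Properties using (cartesianProductWith⁺; allFin⁺; filter⁺)
open import Data.Product using (Σ; ∃; _×_; _,_; proj₁; proj₂)
open import Data.Sum using (inj₁; inj₂)
open import Data.Maybe as Maybe using (Maybe; just; nothing)
open import Data.Maybe.Properties as MaybeP using (just-injective)
open import Relation.Nullary using (¬_; Dec; yes; no; contradiction)
open import Relation.Nullary.Decidable using (map′; _→-dec_; ¬?)
open import Relation.Binary.Definitions using (DecidableEquality)
open import Data.Unit using (⊤; tt)
open import Relation.Binary.PropositionalEquality using (_≡_; _≢_; _≗_; refl; sym; trans; cong; cong₂; subst; subst₂)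

module _ {A : Set} where

  ∈-removeAt⁺ : ∀ {x z : A} {ys} (x∈ys : x ∈ ys) → z ∈ ys → z ≢ x → z ∈ removeAt ys (index x∈ys)
  ∈-removeAt⁺ (here refl) (here refl) z≢x = contradiction refl z≢x
  ∈-removeAt⁺ (here refl) (there z∈ys) _   = z∈ys
  ∈-removeAt⁺ (there _)   (here refl) _    = here refl
  ∈-removeAt⁺ (there x∈ys) (there z∈ys) z≢x = there (∈-removeAt⁺ x∈ys z∈ys z≢x)

module _ {A B : Set} where

  length-≤-injection : (f : A → B) {xs : List A} {ys : List B} → Unique xs →
    (∀ {x} → x ∈ xs → f x ∈ ys) →
    (∀ {x y} → x ∈ xs → y ∈ xs → f x ≡ f y → x ≡ y) →
    length xs ≤ length ys
  length-≤-injection f {[]} _ _ _ = z≤n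
  length-≤-injection f {x ∷ xs} {ys} (x∉xs ∷ unique) into injective =
    subst (suc (length xs) ≤_) (sym (length-removeAt′ ys (index fx∈ys)))
      (s≤s (length-≤-injection f unique into′ (λ x∈ y∈ → injective (there x∈) (there y∈))))
    where
    fx∈ys = into (here refl)
    into′ : ∀ {z} → z ∈ xs → f z ∈ removeAt ys (index fx∈ys)
    into′ z∈xs = ∈-removeAt⁺ fx∈ys (into (there z∈xs))
      (λ fz≡fx → All.lookup x∉xs z∈xs (injective (here refl) (there z∈xs) (sym fz≡fx)))

length-cartesianProductWith : ∀ {A B C : Set} (f : A → B → C) xs ys →
  length (cartesianProductWith f xs ys) ≡ length xs * length ys
length-cartesianProductWith f []       ys = refl
length-cartesianProductWith f (x ∷ xs) ys =
  trans (length-++ (map (f x) ys)) (cong₂ _+_ (length-map (f x) ys) (length-cartesianProductWith f xs ys))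

module _ {A : Set} where

  allVecs : (n : ℕ) → List A → List (Vec A n)
  allVecs zero    xs = [] ∷ []
  allVecs (suc n) xs = cartesianProductWith _∷_ xs (allVecs n xs)

  ∈-allVecs : ∀ {n xs} → (∀ x → x ∈ xs) → (v : Vec A n) → v ∈ allVecs n xs
  ∈-allVecs _    []       = here refl
  ∈-allVecs all (x ∷ v) = ∈-cartesianProductWith⁺ _∷_ (all x) (∈-allVecs all v)

  allVecs-unique : ∀ n {xs} → Unique xs → Unique (allVecs n xs)
  allVecs-unique zero    _ = [] ∷ []
  allVecs-unique (suc n) u = cartesianProductWith⁺ _∷_ VecP.∷-injective u (allVecs-unique n u)

  length-allVecs : ∀ n (xs : List A) → length (allVecs n xs) ≡ length xs ^ n
  length-allVecs zero    xs = refl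
  length-allVecs (suc n) xs =
    trans (length-cartesianProductWith _∷_ xs (allVecs n xs)) (cong (length xs *_) (length-allVecs n xs))

module _ {A B : Set} (f : A → Maybe B) where

  ∈-mapMaybe⁺ : ∀ {x y xs} → x ∈ xs → f x ≡ just y → y ∈ mapMaybe f xs
  ∈-mapMaybe⁺ {x} {xs = _ ∷ _} (here refl) fx≡y with f x
  ... | just _ = here (sym (just-injective fx≡y))
  ∈-mapMaybe⁺ {xs = x′ ∷ _} (there x∈xs) fx≡y with f x′
  ... | just _  = there (∈-mapMaybe⁺ x∈xs fx≡y)
  ... | nothing = ∈-mapMaybe⁺ x∈xs fx≡y

  ∈-mapMaybe⁻ : ∀ {y} xs → y ∈ mapMaybe f xs → ∃ λ x → x ∈ xs × f x ≡ just y
  ∈-mapMaybe⁻ (x ∷ xs) y∈ with f x in fx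
  ∈-mapMaybe⁻ (x ∷ xs) (here refl)  | just _ = x , here refl , fx
  ∈-mapMaybe⁻ (x ∷ xs) (there y∈)   | just _ with x′ , x′∈ , fx′ ← ∈-mapMaybe⁻ xs y∈ = x′ , there x′∈ , fx′
  ∈-mapMaybe⁻ (x ∷ xs) y∈           | nothing with x′ , x′∈ , fx′ ← ∈-mapMaybe⁻ xs y∈ = x′ , there x′∈ , fx′

  mapMaybe-unique : (∀ {x x′ y} → f x ≡ just y → f x′ ≡ just y → x ≡ x′) →
    ∀ {xs} → Unique xs → Unique (mapMaybe f xs)
  mapMaybe-unique injective {[]} [] = []
  mapMaybe-unique injective {x ∷ xs} (x∉xs ∷ unique) with f x in fx
  ... | nothing = mapMaybe-unique injective unique
  ... | just y  = All.tabulate y∉ ∷ mapMaybe-unique injective unique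
    where
    y∉ : ∀ {z} → z ∈ mapMaybe f xs → y ≢ z
    y∉ z∈ refl with x′ , x′∈ , fx′ ← ∈-mapMaybe⁻ xs z∈ = All.lookup x∉xs x′∈ (injective fx fx′)

↑ˡ≢↑ʳ : ∀ {m n} (i : Fin m) (j : Fin n) → i ↑ˡ n ≢ m ↑ʳ j
↑ˡ≢↑ʳ {m} {n} i j same = <⇒≱ (toℕ<n i) (begin
  m              ≤⟨ m≤m+n m (toℕ j) ⟩
  m + toℕ j      ≡⟨ sym (toℕ-↑ʳ m j) ⟩
  toℕ (m ↑ʳ j)   ≡⟨ cong toℕ (sym same) ⟩
  toℕ (i ↑ˡ n)   ≡⟨ toℕ-↑ˡ i n ⟩
  toℕ i          ∎)
  where open ≤-Reasoning

Dist≤-mono : ∀ {G : Graph} {k l u v} → k ≤ l → Dist≤ G k u v → Dist≤ G l u v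
Dist≤-mono k≤l (n , n≤k , u⇝v) = n , ≤-trans n≤k k≤l , u⇝v

module PackingViaPower
  (G : Graph) (_≟V_ : DecidableEquality (V G)) (dist? : ∀ k u v → Dec (Dist≤ G k u v))
  (vertices : List (V G)) (∈-vertices : ∀ v → v ∈ vertices) (vertices-unique : Unique vertices)
  (p : ℕ) where

  -- L v ≡ just i puts the vertex (v , i) of G^[p] into the set encoded by L.
  Labelling : Set
  Labelling = V G → Maybe (Fin p)

  Separated : Maybe (Fin p) → Maybe (Fin p) → V G → V G → Set
  Separated (just i) (just j) u v = i ≡ j → u ≢ v → ¬ Dist≤ G (suc (toℕ i)) u v
  Separated (just i) nothing  u v = ⊤
  Separated nothing  _        u v = ⊤

  separated? : ∀ x y u v → Dec (Separated x y u v)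
  separated? (just i) (just j) u v = (i ≟F j) →-dec (¬? (u ≟V v) →-dec ¬? (dist? _ u v))
  separated? (just i) nothing  u v = yes tt
  separated? nothing  _        u v = yes tt

  IsPackingLabelling : Labelling → Set
  IsPackingLabelling L = ∀ u v → Separated (L u) (L v) u v

  packingLabelling? : ∀ L → Dec (IsPackingLabelling L)
  packingLabelling? L = map′
    (λ all u v → All.lookup (All.lookup all (∈-vertices u)) (∈-vertices v))
    (λ packing → All.tabulate λ {u} _ → All.tabulate λ {v} _ → packing u v)
    (All.all? (λ u → All.all? (λ v → separated? (L u) (L v) u v) vertices) vertices)

  separated : ∀ {L : Labelling} → IsPackingLabelling L → ∀ {u v i} →
    L u ≡ just i → L v ≡ just i → u ≢ v → ¬ Dist≤ G (suc (toℕ i)) u v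
  separated packing {u} {v} Lu Lv = subst₂ (λ x y → Separated x y u v) Lu Lv (packing u v) refl

  IsPackingLabelling-resp-≗ : ∀ {L L′ : Labelling} → L ≗ L′ → IsPackingLabelling L′ → IsPackingLabelling L
  IsPackingLabelling-resp-≗ L≗L′ packing u v =
    subst₂ (λ x y → Separated x y u v) (sym (L≗L′ u)) (sym (L≗L′ v)) (packing u v)

  tag : Labelling → V G → Maybe (V G × Fin p)
  tag L v = Maybe.map (v ,_) (L v)

  tag-just : ∀ {v w : V G} {i} (x : Maybe (Fin p)) → Maybe.map (v ,_) x ≡ just (w , i) → v ≡ w × x ≡ just i
  tag-just (just _) refl = refl , refl

  labelled : Labelling → List (V G × Fin p)
  labelled L = mapMaybe (tag L) vertices

  unlabelled? : ∀ (L : Labelling) v → Dec (L v ≡ nothing)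
  unlabelled? L v = MaybeP.≡-dec _≟F_ (L v) nothing

  unlabelled : Labelling → List (V G)
  unlabelled L = filter (unlabelled? L) vertices

  size : Labelling → ℕ
  size L = length (labelled L)

  ∈-labelled⁺ : ∀ L {v i} → L v ≡ just i → (v , i) ∈ labelled L
  ∈-labelled⁺ L {v} Lv = ∈-mapMaybe⁺ (tag L) (∈-vertices v) (cong (Maybe.map (v ,_)) Lv)

  ∈-labelled⁻ : ∀ L {v i} → (v , i) ∈ labelled L → L v ≡ just i
  ∈-labelled⁻ L {v} {i} v∈ = untag (∈-mapMaybe⁻ (tag L) vertices v∈)
    where
    untag : ∃ (λ w → w ∈ vertices × tag L w ≡ just (v , i)) → L v ≡ just i
    untag (w , _ , tagged) with tag-just (L w) tagged
    ... | refl , Lw = Lw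

  labelled-unique : ∀ L → Unique (labelled L)
  labelled-unique L = mapMaybe-unique (tag L)
    (λ {x} {x′} tx tx′ → trans (proj₁ (tag-just (L x) tx)) (sym (proj₁ (tag-just (L x′) tx′))))
    vertices-unique

  length-labelled+unlabelled : ∀ L → size L + length (unlabelled L) ≡ length vertices
  length-labelled+unlabelled L = go vertices
    where
    go : ∀ vs → length (mapMaybe (tag L) vs) + length (filter (unlabelled? L) vs) ≡ length vs
    go []       = refl
    go (v ∷ vs) with L v
    ... | just _  = cong suc (go vs)
    ... | nothing = trans (+-suc _ _) (cong suc (go vs))

  size-cong : ∀ {L L′ : Labelling} → L ≗ L′ → size L ≡ size L′
  size-cong L≗L′ = cong length (mapMaybe-cong (λ v → cong (Maybe.map (v ,_)) (L≗L′ v)) vertices)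

  Power : Graph
  Power = PowerUpTo G p

  labelled-stable : ∀ L → IsPackingLabelling L → IsStable Power (labelled L)
  labelled-stable L packing u∈ v∈ (inj₁ (refl , u≢v , close)) =
    separated packing (∈-labelled⁻ L u∈) (∈-labelled⁻ L v∈) u≢v close
  labelled-stable L packing u∈ v∈ (inj₂ (refl , i≢j)) =
    i≢j (just-injective (trans (sym (∈-labelled⁻ L u∈)) (∈-labelled⁻ L v∈)))

  labelsOf : List (V G × Fin p) → Labelling
  labelsOf []            v = nothing
  labelsOf ((u , i) ∷ S) v with u ≟V v
  ... | yes _ = just i
  ... | no  _ = labelsOf S v

  labelsOf-just⇒∈ : ∀ S {v i} → labelsOf S v ≡ just i → (v , i) ∈ S
  labelsOf-just⇒∈ ((u , j) ∷ S) {v} Sv with u ≟V v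
  ... | yes refl = here (cong (u ,_) (sym (just-injective Sv)))
  ... | no  _    = there (labelsOf-just⇒∈ S Sv)

  ∈⇒labelsOf-just : ∀ S {v i} → (v , i) ∈ S → ∃ λ j → labelsOf S v ≡ just j
  ∈⇒labelsOf-just ((u , j) ∷ S) {v} v∈ with u ≟V v
  ... | yes _ = j , refl
  ∈⇒labelsOf-just ((u , j) ∷ S) (here refl) | no u≢u = contradiction refl u≢u
  ∈⇒labelsOf-just ((u , j) ∷ S) (there v∈) | no _   = ∈⇒labelsOf-just S v∈

  module _ {S} (stable : IsStable Power S) where

    labelsOf-packing : IsPackingLabelling (labelsOf S)
    labelsOf-packing u v with labelsOf S u in Su | labelsOf S v in Sv
    ... | just i  | just _  = λ where
      refl u≢v close → stable (labelsOf-just⇒∈ S Su) (labelsOf-just⇒∈ S Sv) (inj₁ (refl , u≢v , close))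
    ... | just _  | nothing = tt
    ... | nothing | _       = tt

    ⊆-labelled-labelsOf : ∀ {x} → x ∈ S → x ∈ labelled (labelsOf S)
    ⊆-labelled-labelsOf {v , i} v∈ with ∈⇒labelsOf-just S v∈
    ... | j , Sv with i ≟F j
    ...   | yes refl = ∈-labelled⁺ (labelsOf S) Sv
    ...   | no  i≢j  = contradiction (inj₂ (refl , i≢j)) (stable v∈ (labelsOf-just⇒∈ S Sv))

    length-stable≤size : Unique S → length S ≤ size (labelsOf S)
    length-stable≤size unique = length-≤-injection id unique ⊆-labelled-labelsOf (λ _ _ x≡y → x≡y)

  -- Labellings are not enumerable up to ≡, so the maximum is taken over the tables of their values.
  Table : Set
  Table = Vec (Maybe (Fin p)) (length vertices)

  fromTable : Table → Labelling
  fromTable t v = Vec.lookup t (index (∈-vertices v))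

  toTable : Labelling → Table
  toTable L = Vec.tabulate (λ i → L (List.lookup vertices i))

  fromTable-toTable : ∀ L → fromTable (toTable L) ≗ L
  fromTable-toTable L v =
    trans (VecP.lookup∘tabulate _ (index (∈-vertices v))) (cong L (sym (lookup-index (∈-vertices v))))

  labels : List (Maybe (Fin p))
  labels = nothing ∷ map just (allFin p)

  ∈-labels : ∀ x → x ∈ labels
  ∈-labels nothing  = here refl
  ∈-labels (just i) = there (∈-map⁺ just (∈-allFin i))

  packingTables : List Table
  packingTables = filter (λ t → packingLabelling? (fromTable t)) (allVecs _ labels)

  maximumPackingLabelling :
    ∃ λ L → IsPackingLabelling L × (∀ L′ → IsPackingLabelling L′ → size L′ ≤ size L)
  maximumPackingLabelling = fromTable best , best-packing , best-maximal
    where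
    empty : Table
    empty = Vec.replicate _ nothing

    best : Table
    best = argmax (λ t → size (fromTable t)) empty packingTables

    best-packing : IsPackingLabelling (fromTable best)
    best-packing = argmax-all (λ t → size (fromTable t))
      (IsPackingLabelling-resp-≗ (λ v → VecP.lookup-replicate (index (∈-vertices v)) nothing) (λ _ _ → tt))
      (all-filter (λ t → packingLabelling? (fromTable t)) (allVecs _ labels))

    best-maximal : ∀ L → IsPackingLabelling L → size L ≤ size (fromTable best)
    best-maximal L packing = subst (_≤ size (fromTable best)) (size-cong (fromTable-toTable L))
      (All.lookup (f[xs]≤f[argmax] {f = λ t → size (fromTable t)} empty packingTables)
        (∈-filter⁺ (λ t → packingLabelling? (fromTable t)) (∈-allVecs ∈-labels (toTable L))
          (IsPackingLabelling-resp-≗ (fromTable-toTable L) packing)))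

  p+n∸size≡p+unlabelled : ∀ L → p + length vertices ∸ size L ≡ p + length (unlabelled L)
  p+n∸size≡p+unlabelled L = begin-equality
    p + length vertices ∸ size L                        ≡⟨ cong (λ n → p + n ∸ size L) (sym (length-labelled+unlabelled L)) ⟩
    p + (size L + length (unlabelled L)) ∸ size L       ≡⟨ +-∸-assoc p (m≤m+n (size L) _) ⟩
    p + (size L + length (unlabelled L) ∸ size L)       ≡⟨ cong (p +_) (m+n∸m≡n (size L) _) ⟩
    p + length (unlabelled L)                           ∎
    where open ≤-Reasoning

  module ColouringOf (L : Labelling) (packing : IsPackingLabelling L) where

    data Status (v : V G) : Set where
      labelledAs   : ∀ i → L v ≡ just i → Status v
      unlabelledAt : v ∈ unlabelled L → Status v

    status : ∀ v → Status v
    status v with L v in Lv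
    ... | just i  = labelledAs i Lv
    ... | nothing = unlabelledAt (∈-filter⁺ (unlabelled? L) (∈-vertices v) Lv)

    colourOf : ∀ {v} → Status v → Fin (p + length (unlabelled L))
    colourOf (labelledAs i _)   = i ↑ˡ _
    colourOf (unlabelledAt v∈) = p ↑ʳ index v∈

    colourOf-separated : ∀ {u v} (su : Status u) (sv : Status v) → u ≢ v → colourOf su ≡ colourOf sv →
      ¬ Dist≤ G (suc (toℕ (colourOf su))) u v
    colourOf-separated (labelledAs i Lu) (labelledAs j Lv) u≢v same close
      with refl ← ↑ˡ-injective _ i j same =
      separated packing Lu Lv u≢v (subst (λ k → Dist≤ G (suc k) _ _) (toℕ-↑ˡ i _) close)
    colourOf-separated (labelledAs i _) (unlabelledAt v∈) _ same _ =
      ↑ˡ≢↑ʳ i (index v∈) same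
    colourOf-separated (unlabelledAt u∈) (labelledAs i _) _ same _ =
      ↑ˡ≢↑ʳ i (index u∈) (sym same)
    colourOf-separated (unlabelledAt u∈) (unlabelledAt v∈) u≢v same _ =
      u≢v (trans (lookup-index u∈) (trans (cong (List.lookup (unlabelled L)) (↑ʳ-injective p _ _ same)) (sym (lookup-index v∈))))

    colouring : HasPackingColoring G (p + length (unlabelled L))
    colouring = colour , λ u v u≢v → colourOf-separated (status u) (status v) u≢v
      where
      colour : V G → Fin (p + length (unlabelled L))
      colour v = colourOf (status v)

  module LabellingOf {j} (c : V G → Fin j) (packing : IsPackingColoring G j c) where

    lowColours : Labelling
    lowColours v with toℕ (c v) <? p
    ... | yes c<p = just (fromℕ< c<p)
    ... | no  _   = nothing

    lowColours-just : ∀ {v i} → lowColours v ≡ just i → toℕ (c v) ≡ toℕ i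
    lowColours-just {v} cv≡i with toℕ (c v) <? p
    ... | yes c<p = trans (sym (toℕ-fromℕ< c<p)) (cong toℕ (just-injective cv≡i))

    lowColours-nothing : ∀ {v} → lowColours v ≡ nothing → p ≤ toℕ (c v)
    lowColours-nothing {v} _ with toℕ (c v) <? p
    ... | no c≮p = ≮⇒≥ c≮p

    lowColours-packing : IsPackingLabelling lowColours
    lowColours-packing u v with lowColours u in cu | lowColours v in cv
    ... | just i  | just _  = λ where
      refl u≢v close → packing u v u≢v (toℕ-injective (trans (lowColours-just cu) (sym (lowColours-just cv))))
        (subst (λ k → Dist≤ G (suc k) u v) (sym (lowColours-just cu)) close)
    ... | just _  | nothing = tt
    ... | nothing | _       = tt

    length-unlabelled-lowColours : (∀ u v → Dist≤ G (suc p) u v) →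
      length (unlabelled lowColours) ≤ j ∸ p
    length-unlabelled-lowColours diameter = subst (length (unlabelled lowColours) ≤_) (length-upTo (j ∸ p))
      (length-≤-injection (λ v → toℕ (c v) ∸ p) (filter⁺ _ vertices-unique)
        (λ v∈ → ∈-upTo⁺ (∸-monoˡ-< (toℕ<n (c _)) (high v∈))) injective)
      where
      high : ∀ {v} → v ∈ unlabelled lowColours → p ≤ toℕ (c v)
      high v∈ = lowColours-nothing (proj₂ (∈-filter⁻ (unlabelled? lowColours) {xs = vertices} v∈))

      injective : ∀ {u v} → u ∈ unlabelled lowColours → v ∈ unlabelled lowColours →
        toℕ (c u) ∸ p ≡ toℕ (c v) ∸ p → u ≡ v
      injective {u} {v} u∈ v∈ same with u ≟V v
      ... | yes u≡v = u≡v
      ... | no  u≢v = contradiction (Dist≤-mono (s≤s (high u∈)) (diameter u v))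
        (packing u v u≢v (toℕ-injective (∸-cancelʳ-≡ (high u∈) (high v∈) same)))

  packingChromaticNumber≡p+n∸α : (∀ u v → Dist≤ G (suc p) u v) → (∀ {j} → HasPackingColoring G j → p ≤ j) →
    ∃ λ a → IsStabilityNumber Power a × IsPackingChromaticNumber G (p + length vertices ∸ a)
  packingChromaticNumber≡p+n∸α diameter p≤colours with L , packing , maximal ← maximumPackingLabelling =
    size L , (stableSet , bound) , colouring , minimal
    where
    stableSet : Σ (List (V G × Fin p)) λ S → Unique S × IsStable Power S × length S ≡ size L
    stableSet = labelled L , labelled-unique L , labelled-stable L packing , refl
    bound : ∀ S → Unique S → IsStable Power S → length S ≤ size L
    bound S unique stable = ≤-trans (length-stable≤size stable unique) (maximal _ (labelsOf-packing stable))

    colouring : HasPackingColoring G (p + length vertices ∸ size L)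
    colouring = subst (HasPackingColoring G) (sym (p+n∸size≡p+unlabelled L)) (ColouringOf.colouring L packing)

    minimal : ∀ j → j < p + length vertices ∸ size L → ¬ HasPackingColoring G j
    minimal j j<χ (c , packingC) = <⇒≱ j<χ (begin
      p + length vertices ∸ size L            ≤⟨ ∸-monoʳ-≤ _ (maximal lowColours lowColours-packing) ⟩
      p + length vertices ∸ size lowColours   ≡⟨ p+n∸size≡p+unlabelled lowColours ⟩
      p + length (unlabelled lowColours)      ≤⟨ +-monoʳ-≤ p (length-unlabelled-lowColours diameter) ⟩
      p + (j ∸ p)                             ≡⟨ m+[n∸m]≡n (p≤colours (c , packingC)) ⟩
      j                                       ∎)
      where
      open LabellingOf c packingC
      open ≤-Reasoning

dropFirst : ∀ {A : Set} {m} (k : ℕ) → Vec A m → Vec A (m ∸ k)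
dropFirst zero    v       = v
dropFirst (suc k) []      = []
dropFirst (suc k) (x ∷ v) = dropFirst k v

module _ {q : ℕ} where

  mismatch : Fin q → Fin q → ℕ
  mismatch x y with x ≟F y
  ... | yes _ = 0
  ... | no  _ = 1

  mismatch-refl : ∀ x → mismatch x x ≡ 0
  mismatch-refl x with x ≟F x
  ... | yes _   = refl
  ... | no x≢x = contradiction refl x≢x

  mismatch-≢ : ∀ {x y} → x ≢ y → mismatch x y ≡ 1
  mismatch-≢ {x} {y} x≢y with x ≟F y
  ... | yes x≡y = contradiction x≡y x≢y
  ... | no  _   = refl

  mismatch≤1 : ∀ x y → mismatch x y ≤ 1
  mismatch≤1 x y with x ≟F y
  ... | yes _ = z≤n
  ... | no  _ = ≤-refl

  mismatch-triangle : ∀ x z y → mismatch x y ≤ mismatch x z + mismatch z y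
  mismatch-triangle x z y with x ≟F z | z ≟F y
  ... | yes refl | yes refl = ≤-reflexive (mismatch-refl x)
  ... | yes refl | no  _    = mismatch≤1 x y
  ... | no  _    | _        = m≤n⇒m≤n+o _ (mismatch≤1 x y)

  diffCount-∷ : ∀ {m} x y (u v : Vec (Fin q) m) → diffCount (x ∷ u) (y ∷ v) ≡ mismatch x y + diffCount u v
  diffCount-∷ x y u v with x ≟F y
  ... | yes _ = refl
  ... | no  _ = refl

  diffCount-refl : ∀ {m} (u : Vec (Fin q) m) → diffCount u u ≡ 0
  diffCount-refl []      = refl
  diffCount-refl (x ∷ u) = trans (diffCount-∷ x x u u) (cong₂ _+_ (mismatch-refl x) (diffCount-refl u))

  diffCount-triangle : ∀ {m} (u w v : Vec (Fin q) m) → diffCount u v ≤ diffCount u w + diffCount w v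
  diffCount-triangle []      []      []      = z≤n
  diffCount-triangle (x ∷ u) (z ∷ w) (y ∷ v) = begin
    diffCount (x ∷ u) (y ∷ v)                                        ≡⟨ diffCount-∷ x y u v ⟩
    mismatch x y + diffCount u v                                     ≤⟨ +-mono-≤ (mismatch-triangle x z y) (diffCount-triangle u w v) ⟩
    (mismatch x z + mismatch z y) + (diffCount u w + diffCount w v)  ≡⟨ interchange (mismatch x z) _ _ _ ⟩
    (mismatch x z + diffCount u w) + (mismatch z y + diffCount w v)  ≡⟨ sym (cong₂ _+_ (diffCount-∷ x z u w) (diffCount-∷ z y w v)) ⟩
    diffCount (x ∷ u) (z ∷ w) + diffCount (z ∷ w) (y ∷ v)            ∎
    where open ≤-Reasoning

  diffCount≤length : ∀ {m} (u v : Vec (Fin q) m) → diffCount u v ≤ m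
  diffCount≤length []      []      = z≤n
  diffCount≤length (x ∷ u) (y ∷ v) =
    ≤-trans (≤-reflexive (diffCount-∷ x y u v)) (+-mono-≤ (mismatch≤1 x y) (diffCount≤length u v))

  dropFirst-≡⇒diffCount≤ : ∀ {m} k (u v : Vec (Fin q) m) → dropFirst k u ≡ dropFirst k v → diffCount u v ≤ k
  dropFirst-≡⇒diffCount≤ zero    u       v       u≡v  = ≤-reflexive (trans (cong (diffCount u) (sym u≡v)) (diffCount-refl u))
  dropFirst-≡⇒diffCount≤ (suc k) []      []      _    = z≤n
  dropFirst-≡⇒diffCount≤ (suc k) (x ∷ u) (y ∷ v) same =
    ≤-trans (≤-reflexive (diffCount-∷ x y u v)) (+-mono-≤ (mismatch≤1 x y) (dropFirst-≡⇒diffCount≤ k u v same))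

  walk⇒diffCount≤ : ∀ {m n} {u v : Vec (Fin q) m} → Walk (Hamming q m) u v n → diffCount u v ≤ n
  walk⇒diffCount≤ {u = u} nil = ≤-reflexive (diffCount-refl u)
  walk⇒diffCount≤ {u = u} {v} (cons {w = w} uw w⇝v) = begin
    diffCount u v                  ≤⟨ diffCount-triangle u w v ⟩
    diffCount u w + diffCount w v  ≡⟨ cong (_+ diffCount w v) uw ⟩
    suc (diffCount w v)            ≤⟨ s≤s (walk⇒diffCount≤ w⇝v) ⟩
    suc _                          ∎
    where open ≤-Reasoning

  prependWalk : ∀ {m n} x {u v : Vec (Fin q) m} → Walk (Hamming q m) u v n →
    Walk (Hamming q (suc m)) (x ∷ u) (x ∷ v) n
  prependWalk x nil = nil
  prependWalk x {u} (cons {w = w} uw w⇝v) =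
    cons (trans (diffCount-∷ x x u w) (cong₂ _+_ (mismatch-refl x) uw)) (prependWalk x w⇝v)

  shortestWalk : ∀ {m} (u v : Vec (Fin q) m) → Walk (Hamming q m) u v (diffCount u v)
  shortestWalk []      []      = nil
  shortestWalk (x ∷ u) (y ∷ v) with x ≟F y
  ... | yes refl = prependWalk x (shortestWalk u v)
  ... | no x≢y   = cons headStep (prependWalk y (shortestWalk u v))
    where
    headStep : diffCount (x ∷ u) (y ∷ u) ≡ 1
    headStep = trans (diffCount-∷ x y u u) (cong₂ _+_ (mismatch-≢ x≢y) (diffCount-refl u))

  Dist≤⇒diffCount≤ : ∀ {m k} {u v : Vec (Fin q) m} → Dist≤ (Hamming q m) k u v → diffCount u v ≤ k
  Dist≤⇒diffCount≤ (n , n≤k , u⇝v) = ≤-trans (walk⇒diffCount≤ u⇝v) n≤k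

  diffCount≤⇒Dist≤ : ∀ {m k} (u v : Vec (Fin q) m) → diffCount u v ≤ k → Dist≤ (Hamming q m) k u v
  diffCount≤⇒Dist≤ u v ≤k = diffCount u v , ≤k , shortestWalk u v

  Hamming-Dist≤? : ∀ {m} k (u v : Vec (Fin q) m) → Dec (Dist≤ (Hamming q m) k u v)
  Hamming-Dist≤? k u v = map′ (diffCount≤⇒Dist≤ u v) Dist≤⇒diffCount≤ (diffCount u v ≤? k)

  Hamming-diameter : ∀ {m} (u v : Vec (Fin q) m) → Dist≤ (Hamming q m) m u v
  Hamming-diameter u v = diffCount≤⇒Dist≤ u v (diffCount≤length u v)

words : ∀ q m → List (Vec (Fin q) m)
words q m = allVecs m (allFin q)

∈-words : ∀ {q m} (v : Vec (Fin q) m) → v ∈ words q m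
∈-words = ∈-allVecs ∈-allFin

words-unique : ∀ q m → Unique (words q m)
words-unique q m = allVecs-unique m (allFin⁺ q)

length-words : ∀ q m → length (words q m) ≡ q ^ m
length-words q m = trans (length-allVecs m (allFin q)) (cong (_^ m) (length-tabulate id))

module ColourLayers {q m j} (c : Vec (Fin q) m → Fin j) (packing : IsPackingColoring (Hamming q m) j c) where

  colourClass : ℕ → List (Vec (Fin q) m)
  colourClass t = filter (λ v → toℕ (c v) ≟ t) (words q m)

  coloursFrom : ℕ → List (Vec (Fin q) m)
  coloursFrom t = filter (λ v → t ≤? toℕ (c v)) (words q m)

  length-colourClass : ∀ t → length (colourClass t) ≤ q ^ (m ∸ suc t)
  length-colourClass t = subst (length (colourClass t) ≤_) (length-words q (m ∸ suc t))
    (length-≤-injection (dropFirst (suc t)) (filter⁺ _ (words-unique q m)) (λ _ → ∈-words _) injective)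
    where
    injective : ∀ {u v} → u ∈ colourClass t → v ∈ colourClass t → dropFirst (suc t) u ≡ dropFirst (suc t) v → u ≡ v
    injective {u} {v} u∈ v∈ same with VecP.≡-dec _≟F_ u v
    ... | yes u≡v = u≡v
    ... | no  u≢v = contradiction (diffCount≤⇒Dist≤ u v close) (packing u v u≢v (toℕ-injective (trans cu (sym cv))))
      where
      cu = proj₂ (∈-filter⁻ (λ w → toℕ (c w) ≟ t) {xs = words q m} u∈)
      cv = proj₂ (∈-filter⁻ (λ w → toℕ (c w) ≟ t) {xs = words q m} v∈)
      close : diffCount u v ≤ suc (toℕ (c u))
      close = subst (λ s → diffCount u v ≤ suc s) (sym cu) (dropFirst-≡⇒diffCount≤ (suc t) u v same)

  length-coloursFrom-suc : ∀ t → length (coloursFrom t) ≤ length (colourClass t) + length (coloursFrom (suc t))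
  length-coloursFrom-suc t = subst (length (coloursFrom t) ≤_) (length-++ (colourClass t))
    (length-≤-injection id (filter⁺ _ (words-unique q m)) split (λ _ _ x≡y → x≡y))
    where
    split : ∀ {v} → v ∈ coloursFrom t → v ∈ colourClass t List.++ coloursFrom (suc t)
    split {v} v∈ with m≤n⇒m<n∨m≡n (proj₂ (∈-filter⁻ (λ w → t ≤? toℕ (c w)) {xs = words q m} v∈))
    ... | inj₁ t<cv = ∈-++⁺ʳ (colourClass t) (∈-filter⁺ (λ w → suc t ≤? toℕ (c w)) (∈-words v) t<cv)
    ... | inj₂ t≡cv = ∈-++⁺ˡ (∈-filter⁺ (λ w → toℕ (c w) ≟ t) (∈-words v) (sym t≡cv))

  -- Each layer removes at most q^(m-t-1) ≤ q^(m-t)/2 words, so at least q^(m-t) words remain.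
  q^[m∸t]≤length-coloursFrom : 2 ≤ q → j ≤ m → ∀ t → t ≤ j → q ^ (m ∸ t) ≤ length (coloursFrom t)
  q^[m∸t]≤length-coloursFrom _ _ zero _ = ≤-reflexive (sym (begin-equality
    length (coloursFrom 0) ≡⟨ cong length (filter-all (λ v → 0 ≤? toℕ (c v)) {xs = words q m} (All.tabulate (λ _ → z≤n))) ⟩
    length (words q m)     ≡⟨ length-words q m ⟩
    q ^ m                  ∎))
    where open ≤-Reasoning
  q^[m∸t]≤length-coloursFrom 2≤q j≤m (suc t) t<j = +-cancelˡ-≤ x _ _ (begin
    x + x                                                  ≡⟨ cong (x +_) (sym (+-identityʳ x)) ⟩
    2 * x                                                  ≤⟨ *-monoˡ-≤ x 2≤q ⟩
    q * x                                                  ≡⟨ cong (q ^_) (sym (+-∸-assoc 1 (≤-trans t<j j≤m))) ⟩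
    q ^ (m ∸ t)                                            ≤⟨ q^[m∸t]≤length-coloursFrom 2≤q j≤m t (<⇒≤ t<j) ⟩
    length (coloursFrom t)                                 ≤⟨ length-coloursFrom-suc t ⟩
    length (colourClass t) + length (coloursFrom (suc t))  ≤⟨ +-monoˡ-≤ _ (length-colourClass t) ⟩
    x + length (coloursFrom (suc t))                       ∎)
    where
    open ≤-Reasoning
    x = q ^ (m ∸ suc t)

  coloursFrom-all : coloursFrom j ≡ []
  coloursFrom-all = filter-none (λ v → j ≤? toℕ (c v)) {xs = words q m} (All.tabulate (λ {v} _ → <⇒≱ (toℕ<n (c v))))

Hamming-dimension<packingColours : ∀ {q m j} → 2 ≤ q → HasPackingColoring (Hamming q m) j → m < j
Hamming-dimension<packingColours {q} {m} {j} 2≤q (c , packing) with m <? j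
... | yes m<j = m<j
... | no  m≮j = contradiction no-words-left (<⇒≱ (m^n>0 q {{>-nonZero (<⇒≤ 2≤q)}} (m ∸ j)))
  where
  open ColourLayers c packing
  no-words-left : q ^ (m ∸ j) ≤ 0
  no-words-left = subst (λ ws → q ^ (m ∸ j) ≤ length ws) coloursFrom-all
    (q^[m∸t]≤length-coloursFrom 2≤q (≮⇒≥ m≮j) j ≤-refl)

corollary1 : ∀ (q m : ℕ) → 2 ≤ q → 2 ≤ m →
    ∃ λ a → IsStabilityNumber (PowerUpTo (Hamming q m) (m ∸ 1)) a
          × IsPackingChromaticNumber (Hamming q m) ((m ∸ 1) + q ^ m ∸ a)
corollary1 q m 2≤q _ rewrite sym (length-words q m) = packingChromaticNumber≡p+n∸α diameter p≤colours
  where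
  open PackingViaPower (Hamming q m) (VecP.≡-dec _≟F_) Hamming-Dist≤? (words q m) ∈-words (words-unique q m) (m ∸ 1)

  diameter : ∀ u v → Dist≤ (Hamming q m) (suc (m ∸ 1)) u v
  diameter u v = Dist≤-mono (m≤n+m∸n m 1) (Hamming-diameter u v)

  p≤colours : ∀ {j} → HasPackingColoring (Hamming q m) j → m ∸ 1 ≤ j
  p≤colours colouring = ≤-trans (m∸n≤m m 1) (<⇒≤ (Hamming-dimension<packingColours 2≤q colouring))
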